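{- (1) There is an MS formula $\varphi(N_0,N_1)$ (over the signature $\{\leq\}$, with free set variables $N_0,N_1$) such that for every structure $(N,\leq)$ and subsets $N_0,N_1\subseteq N$, $(N,\leq,N_0,N_1)\models\varphi$ if and only if $(N,\leq,N_0,N_1)=S(J)$ for some SJ-tree $J=(N,\leq,\mathcal U)$. (2) There are MS formulas $\theta_{Ax}(X,N_0,N_1)$ and $\theta(u,U,N_0,N_1)$ such that, in every structure $(N,\leq,N_0,N_1)=S((N,\leq,\mathcal U))$ for an SJ-tree $(N,\leq,\mathcal U)$, $\theta_{Ax}$ holds exactly when $X$ is the axis, and $\theta$ holds exactly when $U\in\mathcal U$ and $u=\widehat U$.
   Context: All sets are finite or countable. A join-tree is $(N,\leq)$ with $\leq$ a partial order on a countable set such that each $\{y\mid y\geq x\}$ is linearly ordered and every two nodes have a join. A line is a linearly ordered convex subset. The top $\widehat X$ of a nonempty set $X$ is the least element of the set of strict upper bounds of $X$, if it exists. A structuring of a join-tree is a set $\mathcal U$ of nonempty lines partitioning $N$ such that exactly one $A\in\mathcal U$ (the axis) is upwards closed, every other $U\in\mathcal U$ has a top, and for every $x$ the sequence $y_0=x$, $y_{i+1}=\widehat{U(y_i)}$ ($U(y)$ the line containing $y$; stopping when $U(y_i)=A$) is finite, its length $k$ (with last element $y_k\in A$) being the depth of $x$. $(N,\leq,\mathcal U)$ is an SJ-tree, and $S(J)=(N,\leq,N_0,N_1)$ where $N_0$ is the set of nodes of even depth and $N_1=N\setminus N_0$. MS logic is first-order logic extended with variables ranging over subsets of the domain and atomic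 formulas $x\in X$. -}

module Defs where

open import Level using (0ℓ)
open import Data.Bool using (Bool; true; false)
open import Data.Nat using (ℕ; zero; suc)
open import Data.Nat.Divisibility using (_∣_)
open import Data.Fin using (Fin; zero; suc)
open import Data.Product using (Σ; _×_; _,_)
open import Data.Sum using (_⊎_)
open import Relation.Nullary using (¬_)
open import Relation.Binary.PropositionalEquality using (_≡_)
open import Function.Definitions using (Injective)
open import Axiom.ExcludedMiddle using (ExcludedMiddle)

_↔_ : ∀ {a b} → Set a → Set b → Set _
A ↔ B = (A → B) × (B → A)
infix 2 _↔_

Countable : Set → Set
Countable N = Σ (N → ℕ) (λ f → Injective _≡_ _≡_ f)

Subset : Set → Set
Subset N = N → Bool

_∈ₛ_ : {N : Set} → N → Subset N → Set
x ∈ₛ X = X x ≡ true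
infix 4 _∈ₛ_

-- Monadic second-order (MS) logic over the signature {≤}
-- Formula n m : n first-order variables and m set variables in scope
-- (de Bruijn indices).

data Formula (n m : ℕ) : Set where
  _≤'_ : Fin n → Fin n → Formula n m
  _≐_  : Fin n → Fin n → Formula n m
  _∈'_ : Fin n → Fin m → Formula n m
  ¬'_  : Formula n m → Formula n m
  _∧'_ : Formula n m → Formula n m → Formula n m
  _∨'_ : Formula n m → Formula n m → Formula n m
  ∃₁ ∀₁ : Formula (suc n) m → Formula n m
  ∃₂ ∀₂ : Formula n (suc m) → Formula n m

extend : ∀ {k} {A : Set} → A → (Fin k → A) → Fin (suc k) → A
extend a ρ zero    = a
extend a ρ (suc i) = ρ i

-- Satisfaction in the structure (N, ≤) under first-order assignment ρ and
-- set assignment σ (quantifiers over subsets range over all subsets).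
Sat : ∀ {n m} {N : Set} (le : N → N → Bool) →
      (Fin n → N) → (Fin m → Subset N) → Formula n m → Set
Sat le ρ σ (i ≤' j) = le (ρ i) (ρ j) ≡ true
Sat le ρ σ (i ≐ j)  = ρ i ≡ ρ j
Sat le ρ σ (i ∈' X) = ρ i ∈ₛ σ X
Sat le ρ σ (¬' φ)   = ¬ Sat le ρ σ φ
Sat le ρ σ (φ ∧' ψ) = Sat le ρ σ φ × Sat le ρ σ ψ
Sat le ρ σ (φ ∨' ψ) = Sat le ρ σ φ ⊎ Sat le ρ σ ψ
Sat {N = N} le ρ σ (∃₁ φ) = Σ N (λ a → Sat le (extend a ρ) σ φ)
Sat {N = N} le ρ σ (∀₁ φ) = (a : N) → Sat le (extend a ρ) σ φ
Sat {N = N} le ρ σ (∃₂ φ) = Σ (Subset N) (λ A → Sat le ρ (extend A σ) φ)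
Sat {N = N} le ρ σ (∀₂ φ) = (A : Subset N) → Sat le ρ (extend A σ) φ

⟨_⟩₁ : {A : Set} → A → Fin 1 → A
⟨ a ⟩₁ zero = a

⟨_,_⟩₂ : {A : Set} → A → A → Fin 2 → A
⟨ a , b ⟩₂ zero = a
⟨ a , b ⟩₂ (suc zero) = b

⟨_,_,_⟩₃ : {A : Set} → A → A → A → Fin 3 → A
⟨ a , b , c ⟩₃ zero = a
⟨ a , b , c ⟩₃ (suc zero) = b
⟨ a , b , c ⟩₃ (suc (suc zero)) = c

noVars : {A : Set} → Fin 0 → A
noVars ()

module Order {N : Set} (le : N → N → Bool) where

  _≼_ : N → N → Set
  x ≼ y = le x y ≡ true

  IsJoin : N → N → N → Set
  IsJoin x y j = x ≼ j × y ≼ j × (∀ z → x ≼ z → y ≼ z → j ≼ z)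

  record IsJoinTree : Set where
    field
      countable : Countable N
      reflexive : ∀ x → x ≼ x
      antisym   : ∀ x y → x ≼ y → y ≼ x → x ≡ y
      trans     : ∀ x y z → x ≼ y → y ≼ z → x ≼ z
      upLinear  : ∀ x y z → x ≼ y → x ≼ z → (y ≼ z) ⊎ (z ≼ y)
      joins     : ∀ x y → Σ N (IsJoin x y)

  IsLine : Subset N → Set
  IsLine U = (∀ x y → x ∈ₛ U → y ∈ₛ U → (x ≼ y) ⊎ (y ≼ x))
           × (∀ x y z → x ∈ₛ U → y ∈ₛ U → x ≼ z → z ≼ y → z ∈ₛ U)

  UpClosed : Subset N → Set
  UpClosed U = ∀ x y → x ∈ₛ U → x ≼ y → y ∈ₛ U

  StrictUpperBound : Subset N → N → Set
  StrictUpperBound X y = ∀ x → x ∈ₛ X → (x ≼ y) × ¬ (x ≡ y)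

  IsTop : Subset N → N → Set
  IsTop X t = StrictUpperBound X t × (∀ y → StrictUpperBound X y → t ≼ y)

  -- Depth x k : the sequence y₀ = x, y_{i+1} = top of the line of y_i
  -- reaches the axis a after k steps.
  data Depth {I : Set} (B : I → Subset N) (a : I) : N → ℕ → Set where
    d-axis : ∀ x → x ∈ₛ B a → Depth B a x zero
    d-step : ∀ x i t k → x ∈ₛ B i → ¬ (i ≡ a) → IsTop (B i) t →
             Depth B a t k → Depth B a x (suc k)

  -- A structuring 𝒰 = { B i | i ∈ I }: a set of nonempty lines partitioning N
  record IsStructuring {I : Set} (B : I → Subset N) : Set where
    field
      nonempty  : ∀ i → Σ N (λ x → x ∈ₛ B i)
      line      : ∀ i → IsLine (B i)
      cover     : ∀ x → Σ I (λ i → x ∈ₛ B i)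
      disjoint  : ∀ i j x → x ∈ₛ B i → x ∈ₛ B j → i ≡ j
      axis      : I
      axisUp    : UpClosed (B axis)
      axisUniq  : ∀ i → UpClosed (B i) → i ≡ axis
      tops      : ∀ i → ¬ (i ≡ axis) → Σ N (IsTop (B i))
      finiteDepth : ∀ x → Σ ℕ (Depth B axis x)

record SJTree (N : Set) (le : N → N → Bool) : Set₁ where
  open Order le
  field
    joinTree    : IsJoinTree
    Idx         : Set
    block       : Idx → Subset N
    structuring : IsStructuring block
  open IsStructuring structuring public

IsS : {N : Set} {le : N → N → Bool} → SJTree N le → Subset N → Subset N → Set
IsS {N} {le} J N₀ N₁ =
    (∀ x → x ∈ₛ N₀ ↔ Σ ℕ (λ k → Depth block axis x k × (2 ∣ k)))
  × (∀ x → x ∈ₛ N₁ ↔ ¬ (x ∈ₛ N₀))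
  where open SJTree J
        open Order le

Proposition3p7 : Set₁
Proposition3p7 =
    Σ (Formula 0 2) (λ φ →
      ExcludedMiddle 0ℓ →
      (N : Set) → Countable N → (le : N → N → Bool) → (N₀ N₁ : Subset N) →
      Sat le noVars ⟨ N₀ , N₁ ⟩₂ φ ↔ Σ (SJTree N le) (λ J → IsS J N₀ N₁))
  × Σ (Formula 0 3) (λ θAx → Σ (Formula 1 3) (λ θ →
      ExcludedMiddle 0ℓ →
      (N : Set) (le : N → N → Bool) (J : SJTree N le) (N₀ N₁ : Subset N) →
      IsS J N₀ N₁ →
        ((X : Subset N) →
           Sat le noVars ⟨ X , N₀ , N₁ ⟩₃ θAx
             ↔ (∀ x → X x ≡ SJTree.block J (SJTree.axis J) x))
      × ((u : N) (U : Subset N) →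
           Sat le ⟨ u ⟩₁ ⟨ U , N₀ , N₁ ⟩₃ θ
             ↔ (Σ (SJTree.Idx J) (λ i → ∀ x → U x ≡ SJTree.block J i x)
                × Order.IsTop le U u))))

-- In S(J) the structuring can be read back from the order and the parity
-- N₀ alone. A node is on the axis iff every node above it is even; two
-- comparable nodes are on the same line iff the parity is constant between
-- them, because a line is convex and its top has depth one less, hence the
-- other parity; tops of lines are then least strict upper bounds. The formula
-- φ asserts the join-tree axioms together with the properties of these
-- definable notions that every SJ-tree has: nodes off the axis have a line
-- top of the other parity, lying on the same line is transitive, and
-- induction along line tops holds (finite depth). Conversely, in a model of φ
-- the same-line classes, each named by its member of least code, form a
-- structuring, and induction on depth shows that N₀ is the set of nodes of
-- even depth.

module Submission where

open import Defs

open import Level using (0ℓ)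
open import Data.Bool using (Bool; true; false; _≟_)
open import Data.Nat using (ℕ; zero; suc; _≤_; _<_)
open import Data.Nat.Induction using (<-wellFounded)
open import Induction.WellFounded using (Acc; acc)
open import Data.Nat.Divisibility using (_∣_; _∣0; ∣-refl; ∣m∣n⇒∣m+n; ∣m+n∣m⇒∣n; ∣1⇒≡1)
open import Data.Nat.Properties using (+-comm; ≤-antisym; ≮⇒≥)
open import Data.Fin using (Fin; zero; suc)
open import Data.Fin.Patterns using (0F; 1F; 2F; 3F)
open import Data.Product using (Σ; _×_; _,_; proj₁; proj₂; map)
open import Data.Sum using (_⊎_; inj₁; inj₂; swap)
open import Relation.Nullary using (¬_; Dec; yes; no; does; contradiction)
open import Relation.Nullary.Decidable using (decidable-stable; dec-true)
open import Relation.Binary.PropositionalEquality using (_≡_; refl; sym; trans; cong; subst)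
open import Axiom.ExcludedMiddle using (ExcludedMiddle)
open import Axiom.UniquenessOfIdentityProofs using (module Decidable⇒UIP)
open Decidable⇒UIP _≟_ using (≡-irrelevant)

private variable
  n m : ℕ
  A B P Q : Set

↔-refl : A ↔ A
↔-refl = (λ a → a) , (λ a → a)

↔-sym : A ↔ B → B ↔ A
↔-sym (f , g) = g , f

↔-trans : A ↔ B → B ↔ P → A ↔ P
↔-trans (f , f⁻) (g , g⁻) = (λ a → g (f a)) , (λ p → f⁻ (g⁻ p))

×-cong : A ↔ P → B ↔ Q → (A × B) ↔ (P × Q)
×-cong (f , f⁻) (g , g⁻) = map f g , map f⁻ g⁻

¬-cong : A ↔ P → (¬ A) ↔ (¬ P)
¬-cong (f , f⁻) = (λ ¬a p → ¬a (f⁻ p)) , (λ ¬p a → ¬p (f a))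

→-cong : A ↔ P → B ↔ Q → (A → B) ↔ (P → Q)
→-cong (f , f⁻) (g , g⁻) = (λ h p → g (h (f⁻ p))) , (λ h a → g⁻ (h (f a)))

Π-cong : {X : Set} {A P : X → Set} → (∀ x → A x ↔ P x) → ((x : X) → A x) ↔ ((x : X) → P x)
Π-cong e = (λ h x → proj₁ (e x) (h x)) , (λ h x → proj₂ (e x) (h x))

Σ-cong : {X : Set} {A P : X → Set} → (∀ x → A x ↔ P x) → Σ X A ↔ Σ X P
Σ-cong e = (λ (x , a) → x , proj₁ (e x) a) , (λ (x , p) → x , proj₂ (e x) p)

module _ (em : ExcludedMiddle 0ℓ) where

  ¬⊎-cong : A ↔ P → B ↔ Q → (¬ A ⊎ B) ↔ (P → Q)
  ¬⊎-cong {A = A} {P = P} {B = B} {Q = Q} (f , f⁻) (g , g⁻) =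
    (λ { (inj₁ ¬a) p → contradiction (f⁻ p) ¬a ; (inj₂ b) _ → g b }) , classical
    where
    classical : (P → Q) → ¬ A ⊎ B
    classical h with em {A}
    ... | yes a = inj₂ (g⁻ (h (f a)))
    ... | no ¬a = inj₁ ¬a

  ⇔-cong : A ↔ P → B ↔ Q → ((¬ A ⊎ B) × (¬ B ⊎ A)) ↔ (P ↔ Q)
  ⇔-cong A⇔P B⇔Q = ×-cong (¬⊎-cong A⇔P B⇔Q) (¬⊎-cong B⇔Q A⇔P)

even-or-odd : ∀ k → 2 ∣ k ⊎ 2 ∣ suc k
even-or-odd zero = inj₁ (2 ∣0)
even-or-odd (suc k) with even-or-odd k
... | inj₁ 2∣k   = inj₂ (∣m∣n⇒∣m+n ∣-refl 2∣k)
... | inj₂ 2∣1+k = inj₁ 2∣1+k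

not-even-and-odd : ∀ {k} → 2 ∣ k → ¬ 2 ∣ suc k
not-even-and-odd {k} 2∣k 2∣1+k with () ← ∣1⇒≡1 (∣m+n∣m⇒∣n (subst (2 ∣_) (+-comm 1 k) 2∣1+k) 2∣k)

parity-mismatch : ∀ {k} → A ↔ 2 ∣ suc k → B ↔ 2 ∣ k → ¬ (A ↔ B)
parity-mismatch {k = k} (A⇒odd , odd⇒A) (B⇒even , even⇒B) (A⇒B , B⇒A) with even-or-odd k
... | inj₁ 2∣k   = not-even-and-odd 2∣k (A⇒odd (B⇒A (even⇒B 2∣k)))
... | inj₂ 2∣1+k = not-even-and-odd (B⇒even (A⇒B (odd⇒A 2∣1+k))) 2∣1+k

parity-flip : ∀ {k} → Dec A → ¬ (A ↔ B) → B ↔ 2 ∣ k → A ↔ 2 ∣ suc k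
parity-flip {A = A} {k = k} A? A≠B (B⇒even , even⇒B) = A⇒odd , odd⇒A
  where
  A⇒odd : A → 2 ∣ suc k
  A⇒odd a with even-or-odd k
  ... | inj₁ 2∣k   = contradiction ((λ _ → even⇒B 2∣k) , (λ _ → a)) A≠B
  ... | inj₂ 2∣1+k = 2∣1+k
  odd⇒A : 2 ∣ suc k → A
  odd⇒A 2∣1+k = decidable-stable A? λ ¬a →
    A≠B ((λ a → contradiction a ¬a) , (λ b → contradiction 2∣1+k (not-even-and-odd (B⇒even b))))

does-true⇒ : (A? : Dec A) → does A? ≡ true → A
does-true⇒ (yes a) _ = a

true-iff↔≡ : ∀ a b → b ≡ true ↔ P → (a ≡ true ↔ P) ↔ (a ≡ b)
true-iff↔≡ a b b⇔P = (λ a⇔P → bool-ext a b (↔-trans a⇔P (↔-sym b⇔P))) , (λ { refl → b⇔P })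
  where
  bool-ext : ∀ a b → (a ≡ true ↔ b ≡ true) → a ≡ b
  bool-ext true  true  _       = refl
  bool-ext true  false (f , _) = sym (f refl)
  bool-ext false true  (_ , g) = g refl
  bool-ext false false _       = refl

module _ {N : Set} {le : N → N → Bool} where
  open Order le

  top-unique : (∀ x y → x ≼ y → y ≼ x → x ≡ y) →
               ∀ {X t t′} → IsTop X t → IsTop X t′ → t ≡ t′
  top-unique antisym (bound , least) (bound′ , least′) = antisym _ _ (least _ bound′) (least′ _ bound)

module ParityLines {N : Set} (le : N → N → Bool) (N₀ : Subset N) where
  open Order le

  SameParity : N → N → Set
  SameParity x y = x ∈ₛ N₀ ↔ y ∈ₛ N₀

  Between : N → N → N → Set
  Between x z y = x ≼ z × z ≼ y

  SameLine : N → N → Set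
  SameLine x y = (x ≼ y ⊎ y ≼ x) × (∀ z → Between x z y ⊎ Between y z x → SameParity x z)

  InAxis : N → Set
  InAxis x = ∀ y → x ≼ y → y ∈ₛ N₀

  BoundsLineOf : N → N → Set
  BoundsLineOf x s = ∀ y → SameLine x y → y ≼ s × ¬ y ≡ s

  IsLineTop : N → N → Set
  IsLineTop x t = BoundsLineOf x t × (∀ s → BoundsLineOf x s → t ≼ s)

module _ {N : Set} {le : N → N → Bool} {N₀ : Subset N} where
  open Order le
  open ParityLines le N₀

  IsLineTop⇔IsTop : ∀ {U x t} → (∀ y → y ∈ₛ U ↔ SameLine x y) → IsLineTop x t ↔ IsTop U t
  IsLineTop⇔IsTop {U} {x} U-is-line = ×-cong bounds (Π-cong λ _ → →-cong bounds ↔-refl)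
    where
    bounds : ∀ {s} → BoundsLineOf x s ↔ StrictUpperBound U s
    bounds = Π-cong λ y → →-cong (↔-sym (U-is-line y)) ↔-refl

_⇒′_ : Formula n m → Formula n m → Formula n m
φ ⇒′ ψ = (¬' φ) ∨' ψ

_⇔′_ : Formula n m → Formula n m → Formula n m
φ ⇔′ ψ = (φ ⇒′ ψ) ∧' (ψ ⇒′ φ)

infixr 4 _⇒′_
infix 4 _⇔′_

strictlyBelowᶠ : Fin n → Fin n → Formula n m
strictlyBelowᶠ y s = (y ≤' s) ∧' (¬' (y ≐ s))

sameParityᶠ : Fin n → Fin n → Fin m → Formula n m
sameParityᶠ x y k = x ∈' k ⇔′ y ∈' k

betweenᶠ : Fin n → Fin n → Fin n → Formula n m
betweenᶠ x z y = (x ≤' z) ∧' (z ≤' y)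

sameLineᶠ : Fin n → Fin n → Fin m → Formula n m
sameLineᶠ x y k = ((x ≤' y) ∨' (y ≤' x))
  ∧' ∀₁ ((betweenᶠ (suc x) zero (suc y) ∨' betweenᶠ (suc y) zero (suc x)) ⇒′ sameParityᶠ (suc x) zero k)

inAxisᶠ : Fin n → Fin m → Formula n m
inAxisᶠ x k = ∀₁ ((suc x ≤' zero) ⇒′ (zero ∈' k))

boundsLineOfᶠ : Fin n → Fin n → Fin m → Formula n m
boundsLineOfᶠ x s k = ∀₁ (sameLineᶠ (suc x) zero k ⇒′ strictlyBelowᶠ zero (suc s))

isLineTopᶠ : Fin n → Fin n → Fin m → Formula n m
isLineTopᶠ x t k = boundsLineOfᶠ x t k ∧' ∀₁ (boundsLineOfᶠ (suc x) zero k ⇒′ (suc t ≤' zero))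

strictUpperBoundᶠ : Fin n → Fin m → Formula n m
strictUpperBoundᶠ s U = ∀₁ ((zero ∈' U) ⇒′ strictlyBelowᶠ zero (suc s))

isTopᶠ : Fin n → Fin m → Formula n m
isTopᶠ t U = strictUpperBoundᶠ t U ∧' ∀₁ (strictUpperBoundᶠ zero U ⇒′ (suc t ≤' zero))

module Semantics (em : ExcludedMiddle 0ℓ) {N : Set} (le : N → N → Bool) where
  open Order le
  open ParityLines le

  sat-sameParityᶠ : (ρ : Fin n → N) (σ : Fin m → Subset N) (x y : Fin n) (k : Fin m) →
                    Sat le ρ σ (sameParityᶠ x y k) ↔ SameParity (σ k) (ρ x) (ρ y)
  sat-sameParityᶠ ρ σ x y k = ⇔-cong em ↔-refl ↔-refl

  sat-sameLineᶠ : (ρ : Fin n → N) (σ : Fin m → Subset N) (x y : Fin n) (k : Fin m) →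
                  Sat le ρ σ (sameLineᶠ x y k) ↔ SameLine (σ k) (ρ x) (ρ y)
  sat-sameLineᶠ ρ σ x y k =
    ×-cong ↔-refl (Π-cong λ z → ¬⊎-cong em ↔-refl (sat-sameParityᶠ (extend z ρ) σ (suc x) zero k))

  sat-inAxisᶠ : (ρ : Fin n → N) (σ : Fin m → Subset N) (x : Fin n) (k : Fin m) →
                Sat le ρ σ (inAxisᶠ x k) ↔ InAxis (σ k) (ρ x)
  sat-inAxisᶠ ρ σ x k = Π-cong λ _ → ¬⊎-cong em ↔-refl ↔-refl

  sat-boundsLineOfᶠ : (ρ : Fin n → N) (σ : Fin m → Subset N) (x s : Fin n) (k : Fin m) →
                      Sat le ρ σ (boundsLineOfᶠ x s k) ↔ BoundsLineOf (σ k) (ρ x) (ρ s)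
  sat-boundsLineOfᶠ ρ σ x s k =
    Π-cong λ y → ¬⊎-cong em (sat-sameLineᶠ (extend y ρ) σ (suc x) zero k) ↔-refl

  sat-isLineTopᶠ : (ρ : Fin n → N) (σ : Fin m → Subset N) (x t : Fin n) (k : Fin m) →
                   Sat le ρ σ (isLineTopᶠ x t k) ↔ IsLineTop (σ k) (ρ x) (ρ t)
  sat-isLineTopᶠ ρ σ x t k = ×-cong (sat-boundsLineOfᶠ ρ σ x t k)
    (Π-cong λ s → ¬⊎-cong em (sat-boundsLineOfᶠ (extend s ρ) σ (suc x) zero k) ↔-refl)

  sat-strictUpperBoundᶠ : (ρ : Fin n → N) (σ : Fin m → Subset N) (s : Fin n) (U : Fin m) →
                          Sat le ρ σ (strictUpperBoundᶠ s U) ↔ StrictUpperBound (σ U) (ρ s)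
  sat-strictUpperBoundᶠ ρ σ s U = Π-cong λ _ → ¬⊎-cong em ↔-refl ↔-refl

  sat-isTopᶠ : (ρ : Fin n → N) (σ : Fin m → Subset N) (t : Fin n) (U : Fin m) →
               Sat le ρ σ (isTopᶠ t U) ↔ IsTop (σ U) (ρ t)
  sat-isTopᶠ ρ σ t U = ×-cong (sat-strictUpperBoundᶠ ρ σ t U)
    (Π-cong λ s → ¬⊎-cong em (sat-strictUpperBoundᶠ (extend s ρ) σ zero U) ↔-refl)

record SJAxioms {N : Set} (le : N → N → Bool) (N₀ N₁ : Subset N) : Set where
  open Order le
  open ParityLines le N₀
  field
    reflexive : ∀ x → x ≼ x
    antisym : ∀ x y → x ≼ y → y ≼ x → x ≡ y
    transitive : ∀ x y z → x ≼ y → y ≼ z → x ≼ z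
    upLinear : ∀ x y z → x ≼ y → x ≼ z → y ≼ z ⊎ z ≼ y
    joins : ∀ x y → Σ N (IsJoin x y)
    complement : ∀ x → x ∈ₛ N₁ ↔ ¬ x ∈ₛ N₀
    axisNonempty : Σ N InAxis
    lineTops : ∀ x → ¬ InAxis x → Σ N λ t → IsLineTop x t × ¬ SameParity x t
    sameLine-trans : ∀ x y z → SameLine x y → SameLine y z → SameLine x z
    lineTop-induction : (Y : Subset N) →
      (∀ x → InAxis x → x ∈ₛ Y) × (∀ x → ¬ InAxis x → (∀ t → IsLineTop x t → t ∈ₛ Y) → x ∈ₛ Y) →
      ∀ x → x ∈ₛ Y

reflexiveᶠ antisymᶠ transitiveᶠ upLinearᶠ joinsᶠ complementᶠ axisNonemptyᶠ lineTopsᶠ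
  sameLine-transᶠ lineTop-inductionᶠ φ : Formula 0 2
reflexiveᶠ = ∀₁ (0F ≤' 0F)
antisymᶠ = ∀₁ (∀₁ (1F ≤' 0F ⇒′ 0F ≤' 1F ⇒′ 1F ≐ 0F))
transitiveᶠ = ∀₁ (∀₁ (∀₁ (2F ≤' 1F ⇒′ 1F ≤' 0F ⇒′ 2F ≤' 0F)))
upLinearᶠ = ∀₁ (∀₁ (∀₁ (2F ≤' 1F ⇒′ 2F ≤' 0F ⇒′ (1F ≤' 0F) ∨' (0F ≤' 1F))))
joinsᶠ = ∀₁ (∀₁ (∃₁ ((2F ≤' 0F) ∧' ((1F ≤' 0F) ∧' ∀₁ (3F ≤' 0F ⇒′ 2F ≤' 0F ⇒′ 1F ≤' 0F)))))
complementᶠ = ∀₁ (0F ∈' 1F ⇔′ ¬' (0F ∈' 0F))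
axisNonemptyᶠ = ∃₁ (inAxisᶠ 0F 0F)
lineTopsᶠ = ∀₁ (¬' inAxisᶠ 0F 0F ⇒′
  ∃₁ (isLineTopᶠ 1F 0F 0F ∧' (¬' sameParityᶠ 1F 0F 0F)))
sameLine-transᶠ = ∀₁ (∀₁ (∀₁
  (sameLineᶠ 2F 1F 0F ⇒′ sameLineᶠ 1F 0F 0F ⇒′ sameLineᶠ 2F 0F 0F)))
lineTop-inductionᶠ = ∀₂ (
  (∀₁ (inAxisᶠ 0F 1F ⇒′ 0F ∈' 0F) ∧'
   ∀₁ (¬' inAxisᶠ 0F 1F ⇒′ ∀₁ (isLineTopᶠ 1F 0F 1F ⇒′ 0F ∈' 0F) ⇒′ 0F ∈' 0F))
  ⇒′ ∀₁ (0F ∈' 0F))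
φ = reflexiveᶠ ∧' (antisymᶠ ∧' (transitiveᶠ ∧' (upLinearᶠ ∧' (joinsᶠ ∧' (complementᶠ
  ∧' (axisNonemptyᶠ ∧' (lineTopsᶠ ∧' (sameLine-transᶠ ∧' lineTop-inductionᶠ))))))))

θAx : Formula 0 3
θAx = ∀₁ (0F ∈' 0F ⇔′ inAxisᶠ 0F 1F)

θ : Formula 1 3
θ = ∃₁ ((0F ∈' 0F) ∧' ∀₁ (0F ∈' 0F ⇔′ sameLineᶠ 1F 0F 1F)) ∧' isTopᶠ 0F 0F

module _ (em : ExcludedMiddle 0ℓ) {N : Set} (le : N → N → Bool) (N₀ N₁ : Subset N) where
  open Semantics em le
  open ParityLines le N₀

  private
    σ : Fin 2 → Subset N
    σ = ⟨ N₀ , N₁ ⟩₂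

    classical-→ : ∀ {A B Q : Set} → B ↔ Q → (¬ A ⊎ B) ↔ (A → Q)
    classical-→ = ¬⊎-cong em ↔-refl

  sat-lineTopsᶠ : Sat le noVars σ lineTopsᶠ ↔
                  (∀ x → ¬ InAxis x → Σ N λ t → IsLineTop x t × ¬ SameParity x t)
  sat-lineTopsᶠ = Π-cong λ x → ¬⊎-cong em (¬-cong (sat-inAxisᶠ (extend x noVars) σ 0F 0F)) (Σ-cong λ t →
    let ρ = extend t (extend x noVars) in
    ×-cong (sat-isLineTopᶠ ρ σ 1F 0F 0F) (¬-cong (sat-sameParityᶠ ρ σ 1F 0F 0F)))

  sat-sameLine-transᶠ : Sat le noVars σ sameLine-transᶠ ↔
                        (∀ x y z → SameLine x y → SameLine y z → SameLine x z)
  sat-sameLine-transᶠ = Π-cong λ x → Π-cong λ y → Π-cong λ z →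
    let ρ = extend z (extend y (extend x noVars)) in
    ¬⊎-cong em (sat-sameLineᶠ ρ σ 2F 1F 0F)
      (¬⊎-cong em (sat-sameLineᶠ ρ σ 1F 0F 0F) (sat-sameLineᶠ ρ σ 2F 0F 0F))

  sat-lineTop-inductionᶠ : Sat le noVars σ lineTop-inductionᶠ ↔
    ((Y : Subset N) →
      (∀ x → InAxis x → x ∈ₛ Y) × (∀ x → ¬ InAxis x → (∀ t → IsLineTop x t → t ∈ₛ Y) → x ∈ₛ Y) →
      ∀ x → x ∈ₛ Y)
  sat-lineTop-inductionᶠ = Π-cong λ Y → ¬⊎-cong em (×-cong
    (Π-cong λ x → ¬⊎-cong em (inAxis Y x) ↔-refl)
    (Π-cong λ x → ¬⊎-cong em (¬-cong (inAxis Y x)) (¬⊎-cong em (Π-cong λ t →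
       ¬⊎-cong em (sat-isLineTopᶠ (extend t (extend x noVars)) (extend Y σ) 1F 0F 1F) ↔-refl) ↔-refl)))
    ↔-refl
    where
    inAxis : ∀ Y x → Sat le (extend x noVars) (extend Y σ) (inAxisᶠ 0F 1F) ↔ InAxis x
    inAxis Y x = sat-inAxisᶠ (extend x noVars) (extend Y σ) 0F 1F

  sat-φ : Sat le noVars σ φ ↔ SJAxioms le N₀ N₁
  sat-φ = ↔-trans
    (×-cong ↔-refl
    (×-cong (Π-cong λ _ → Π-cong λ _ → classical-→ (classical-→ ↔-refl))
    (×-cong (Π-cong λ _ → Π-cong λ _ → Π-cong λ _ → classical-→ (classical-→ ↔-refl))
    (×-cong (Π-cong λ _ → Π-cong λ _ → Π-cong λ _ → classical-→ (classical-→ ↔-refl))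
    (×-cong (Π-cong λ _ → Π-cong λ _ → Σ-cong λ _ →
               ×-cong ↔-refl (×-cong ↔-refl (Π-cong λ _ → classical-→ (classical-→ ↔-refl))))
    (×-cong (Π-cong λ _ → ⇔-cong em ↔-refl ↔-refl)
    (×-cong (Σ-cong λ x → sat-inAxisᶠ (extend x noVars) σ 0F 0F)
    (×-cong sat-lineTopsᶠ
    (×-cong sat-sameLine-transᶠ sat-lineTop-inductionᶠ)))))))))
    ( (λ (r , a , t , u , j , c , ax , lt , sl , ind) → record
          { reflexive = r ; antisym = a ; transitive = t ; upLinear = u ; joins = j ; complement = c
          ; axisNonempty = ax ; lineTops = lt ; sameLine-trans = sl ; lineTop-induction = ind })
    , (λ A → let open SJAxioms A in reflexive , antisym , transitive , upLinear , joins , complement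
                                   , axisNonempty , lineTops , sameLine-trans , lineTop-induction))

module SJTreeFacts (em : ExcludedMiddle 0ℓ) {N : Set} {le : N → N → Bool} (J : SJTree N le)
                   (N₀ N₁ : Subset N) (J-is-S : IsS J N₀ N₁) where
  open SJTree J
  open Order le
  open IsJoinTree joinTree renaming (reflexive to ≼-refl; antisym to ≼-antisym; trans to ≼-trans)
  open ParityLines le N₀

  private variable
    x y z t : N
    i : Idx
    k : ℕ

  HasDepth : N → ℕ → Set
  HasDepth = Depth block axis

  axis-exclusive : x ∈ₛ block i → ¬ i ≡ axis → ¬ x ∈ₛ block axis
  axis-exclusive {i = i} xi i≢axis xa = i≢axis (disjoint i axis _ xi xa)

  depth-unique : ∀ {k k′} → HasDepth x k → HasDepth x k′ → k ≡ k′
  depth-unique (d-axis _ _) (d-axis _ _) = refl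
  depth-unique (d-axis _ xa) (d-step _ _ _ _ xi i≢axis _ _) = contradiction xa (axis-exclusive xi i≢axis)
  depth-unique (d-step _ _ _ _ xi i≢axis _ _) (d-axis _ xa) = contradiction xa (axis-exclusive xi i≢axis)
  depth-unique (d-step x i t _ xi _ T d) (d-step .x i′ t′ _ xi′ _ T′ d′)
    with refl ← disjoint i i′ x xi xi′ with refl ← top-unique ≼-antisym T T′ =
    cong suc (depth-unique d d′)

  depth-parity : HasDepth x k → x ∈ₛ N₀ ↔ 2 ∣ k
  depth-parity {x} {k} d =
      (λ x∈N₀ → let (k′ , d′ , 2∣k′) = proj₁ (proj₁ J-is-S x) x∈N₀ in
                 subst (2 ∣_) (depth-unique d′ d) 2∣k′)
    , (λ 2∣k → proj₂ (proj₁ J-is-S x) (k , d , 2∣k))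

  depth-of-block : x ∈ₛ block i → y ∈ₛ block i → HasDepth x k → HasDepth y k
  depth-of-block {i = i} {y = y} xi yi (d-axis x xa) =
    d-axis y (subst (λ j → y ∈ₛ block j) (disjoint i axis x xi xa) yi)
  depth-of-block {i = i} {y = y} xi yi (d-step x i′ t k xi′ i′≢axis T d) =
    d-step y i′ t k (subst (λ j → y ∈ₛ block j) (disjoint i i′ x xi xi′) yi) i′≢axis T d

  block-sameParity : x ∈ₛ block i → y ∈ₛ block i → SameParity x y
  block-sameParity {x} xi yi with finiteDepth x
  ... | _ , d = ↔-trans (depth-parity d) (↔-sym (depth-parity (depth-of-block xi yi d)))

  top-flips-parity : x ∈ₛ block i → ¬ i ≡ axis → IsTop (block i) t → ¬ SameParity x t
  top-flips-parity {x} {i} {t} xi i≢axis T with finiteDepth t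
  ... | k , d = parity-mismatch (depth-parity (d-step x i t k xi i≢axis T d)) (depth-parity d)

  axis⇒InAxis : x ∈ₛ block axis → InAxis x
  axis⇒InAxis {x} xa y x≼y = proj₂ (depth-parity (d-axis y (axisUp x y xa x≼y))) (2 ∣0)

  InAxis⇒axis : InAxis x → x ∈ₛ block axis
  InAxis⇒axis {x} x-in-axis with cover x
  ... | i , xi with em {i ≡ axis}
  ...   | yes refl = xi
  ...   | no i≢axis with tops i i≢axis
  ...     | t , T = contradiction
          ((λ _ → x-in-axis t (proj₁ (proj₁ T x xi))) , (λ _ → x-in-axis x (≼-refl x)))
          (top-flips-parity xi i≢axis T)

  leaving-block⇒strictUpperBound : x ∈ₛ block i → x ≼ y → ¬ y ∈ₛ block i → StrictUpperBound (block i) y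
  leaving-block⇒strictUpperBound {x} {i} {y} xi x≼y y∉i u ui = u≼y , λ { refl → y∉i ui }
    where
    u≼y : u ≼ y
    u≼y with proj₁ (line i) u x ui xi
    ... | inj₁ u≼x = ≼-trans u x y u≼x x≼y
    ... | inj₂ x≼u with upLinear x u y x≼u x≼y
    ...   | inj₁ u≼y = u≼y
    ...   | inj₂ y≼u = contradiction (proj₂ (line i) x u y xi ui x≼y y≼u) y∉i

  -- a line can only be left upwards through its top, where the parity changes
  block-extends : x ∈ₛ block i → x ≼ y → (∀ z → x ≼ z → z ≼ y → SameParity x z) → y ∈ₛ block i
  block-extends {x} {i} {y} xi x≼y constant with em {y ∈ₛ block i} | em {i ≡ axis}
  ... | yes yi | _ = yi
  ... | no y∉i | yes refl = contradiction (axisUp x y xi x≼y) y∉i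
  ... | no y∉i | no i≢axis with tops i i≢axis
  ...   | t , T = contradiction
          (constant t (proj₁ (proj₁ T x xi)) (proj₂ T y (leaving-block⇒strictUpperBound xi x≼y y∉i)))
          (top-flips-parity xi i≢axis T)

  SameLine⇒common-block : SameLine x y → Σ Idx λ i → x ∈ₛ block i × y ∈ₛ block i
  SameLine⇒common-block {x} {y} (inj₁ x≼y , between) with cover x
  ... | i , xi = i , xi , block-extends xi x≼y λ z x≼z z≼y → between z (inj₁ (x≼z , z≼y))
  SameLine⇒common-block {x} {y} (inj₂ y≼x , between) with cover y
  ... | i , yi = i , block-extends yi y≼x constant , yi
    where
    constant : ∀ z → y ≼ z → z ≼ x → SameParity y z
    constant z y≼z z≼x =
      ↔-trans (↔-sym (between y (inj₂ (≼-refl y , y≼x)))) (between z (inj₂ (y≼z , z≼x)))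

  common-block⇒SameLine : x ∈ₛ block i → y ∈ₛ block i → SameLine x y
  common-block⇒SameLine {x} {i} {y} xi yi = proj₁ (line i) x y xi yi , λ
    { z (inj₁ (x≼z , z≼y)) → block-sameParity xi (proj₂ (line i) x y z xi yi x≼z z≼y)
    ; z (inj₂ (y≼z , z≼x)) → block-sameParity xi (proj₂ (line i) y x z yi xi y≼z z≼x) }

  SameLine⇔block : x ∈ₛ block i → SameLine x y ↔ y ∈ₛ block i
  SameLine⇔block {x} {i} {y} xi = to , common-block⇒SameLine xi
    where
    to : SameLine x y → y ∈ₛ block i
    to x~y with SameLine⇒common-block x~y
    ... | j , xj , yj = subst (λ j → y ∈ₛ block j) (disjoint j i x xj xi) yj

  IsLineTop⇔IsTop-block : x ∈ₛ block i → IsLineTop x t ↔ IsTop (block i) t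
  IsLineTop⇔IsTop-block xi = IsLineTop⇔IsTop λ y → ↔-sym (SameLine⇔block xi)

  S-satisfies-SJAxioms : SJAxioms le N₀ N₁
  S-satisfies-SJAxioms = record
    { reflexive = ≼-refl
    ; antisym = ≼-antisym
    ; transitive = ≼-trans
    ; upLinear = upLinear
    ; joins = joins
    ; complement = proj₂ J-is-S
    ; axisNonempty = let (x , xa) = nonempty axis in x , axis⇒InAxis xa
    ; lineTops = line-top
    ; sameLine-trans = λ _ _ _ → SameLine-trans
    ; lineTop-induction = λ Y (base , step) x → induction Y base step (proj₂ (finiteDepth x))
    }
    where
    line-top : ∀ x → ¬ InAxis x → Σ N λ t → IsLineTop x t × ¬ SameParity x t
    line-top x x∉axis with cover x
    ... | i , xi with em {i ≡ axis}
    ...   | yes refl = contradiction (axis⇒InAxis xi) x∉axis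
    ...   | no i≢axis with tops i i≢axis
    ...     | t , T = t , proj₂ (IsLineTop⇔IsTop-block xi) T , top-flips-parity xi i≢axis T

    SameLine-trans : SameLine x y → SameLine y z → SameLine x z
    SameLine-trans {x} {y} {z} x~y y~z with SameLine⇒common-block x~y | SameLine⇒common-block y~z
    ... | i , xi , yi | j , yj , zj =
      common-block⇒SameLine xi (subst (λ i → z ∈ₛ block i) (disjoint j i y yj yi) zj)

    induction : (Y : Subset N) → (∀ x → InAxis x → x ∈ₛ Y) →
                (∀ x → ¬ InAxis x → (∀ t → IsLineTop x t → t ∈ₛ Y) → x ∈ₛ Y) →
                HasDepth x k → x ∈ₛ Y
    induction Y base step (d-axis x xa) = base x (axis⇒InAxis xa)
    induction Y base step (d-step x i t k xi i≢axis T d) =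
      step x (λ x-in-axis → axis-exclusive xi i≢axis (InAxis⇒axis x-in-axis)) λ t′ T′ →
        subst (_∈ₛ Y) (top-unique ≼-antisym T (proj₁ (IsLineTop⇔IsTop-block xi) T′))
          (induction Y base step d)

  axis-defined-by-InAxis : (X : Subset N) → (∀ x → x ∈ₛ X ↔ InAxis x) ↔ (∀ x → X x ≡ block axis x)
  axis-defined-by-InAxis X = Π-cong λ x → true-iff↔≡ (X x) (block axis x) (axis⇒InAxis , InAxis⇒axis)

  lines-defined-by-SameLine : (U : Subset N) →
    Σ N (λ x → x ∈ₛ U × (∀ y → y ∈ₛ U ↔ SameLine x y)) ↔ Σ Idx (λ i → ∀ y → U y ≡ block i y)
  lines-defined-by-SameLine U = to , from
    where
    to : Σ N (λ x → x ∈ₛ U × (∀ y → y ∈ₛ U ↔ SameLine x y)) → Σ Idx (λ i → ∀ y → U y ≡ block i y)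
    to (x , _ , U-is-line) with cover x
    ... | i , xi = i , λ y →
      proj₁ (true-iff↔≡ (U y) (block i y) (↔-sym (SameLine⇔block xi))) (U-is-line y)
    from : Σ Idx (λ i → ∀ y → U y ≡ block i y) → Σ N (λ x → x ∈ₛ U × (∀ y → y ∈ₛ U ↔ SameLine x y))
    from (i , U≗i) with nonempty i
    ... | x , xi = x , trans (U≗i x) xi
                 , λ y → proj₂ (true-iff↔≡ (U y) (block i y) (↔-sym (SameLine⇔block xi))) (U≗i y)

module SJTreeFromAxioms (em : ExcludedMiddle 0ℓ) {N : Set} (countable : Countable N)
                        {le : N → N → Bool} {N₀ N₁ : Subset N} (axioms : SJAxioms le N₀ N₁) where
  open Order le
  open ParityLines le N₀
  open SJAxioms axioms

  private variable
    x y z t : N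

  code : N → ℕ
  code = proj₁ countable

  ≡⇒SameParity : x ≡ y → SameParity x y
  ≡⇒SameParity refl = ↔-refl

  SameLine-refl : ∀ x → SameLine x x
  SameLine-refl x = inj₁ (reflexive x) , λ
    { z (inj₁ (x≼z , z≼x)) → ≡⇒SameParity (antisym x z x≼z z≼x)
    ; z (inj₂ (x≼z , z≼x)) → ≡⇒SameParity (antisym x z x≼z z≼x) }

  SameLine⇒SameParity : SameLine x y → SameParity x y
  SameLine⇒SameParity {y = y} (inj₁ x≼y , between) = between y (inj₁ (x≼y , reflexive y))
  SameLine⇒SameParity {y = y} (inj₂ y≼x , between) = between y (inj₂ (reflexive y , y≼x))

  SameLine-sym : SameLine x y → SameLine y x
  SameLine-sym x~y@(comparable , between) =
    swap comparable , λ z y-z-x → ↔-trans (↔-sym (SameLine⇒SameParity x~y)) (between z (swap y-z-x))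

  Canonical : N → Set
  Canonical r = ∀ y → SameLine r y → code r ≤ code y

  canonical-exists : ∀ x → Σ N λ r → SameLine x r × Canonical r
  canonical-exists x = descend x (<-wellFounded (code x)) (SameLine-refl x)
    where
    descend : ∀ y → Acc _<_ (code y) → SameLine x y → Σ N λ r → SameLine x r × Canonical r
    descend y (acc smaller) x~y with em {Σ N λ z → SameLine y z × code z < code y}
    ... | yes (z , y~z , z<y) = descend z (smaller z<y) (sameLine-trans x y z x~y y~z)
    ... | no no-smaller = y , x~y , λ z y~z → ≮⇒≥ λ z<y → no-smaller (z , y~z , z<y)

  canonical-unique : ∀ {r r′} → SameLine r r′ → Canonical r → Canonical r′ → r ≡ r′
  canonical-unique r~r′ r-canonical r′-canonical =
    proj₂ countable (≤-antisym (r-canonical _ r~r′) (r′-canonical _ (SameLine-sym r~r′)))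

  -- A line is named by its representative of least code; recording
  -- canonicity as a boolean equation makes equal representatives give
  -- equal names.
  Line : Set
  Line = Σ N λ r → does (em {Canonical r}) ≡ true

  Line-≡ : {l l′ : Line} → proj₁ l ≡ proj₁ l′ → l ≡ l′
  Line-≡ {r , p} {.r , p′} refl = cong (r ,_) (≡-irrelevant p p′)

  lineOf : N → Line
  lineOf x = let (r , _ , r-canonical) = canonical-exists x in r , dec-true em r-canonical

  members : Line → Subset N
  members (r , _) x = does (em {SameLine r x})

  ∈-members : ∀ l x → x ∈ₛ members l ↔ SameLine (proj₁ l) x
  ∈-members _ _ = does-true⇒ em , dec-true em

  ∈-lineOf : ∀ x → x ∈ₛ members (lineOf x)
  ∈-lineOf x = proj₂ (∈-members (lineOf x) x) (SameLine-sym (proj₁ (proj₂ (canonical-exists x))))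

  members-of : ∀ l → x ∈ₛ members l → y ∈ₛ members l ↔ SameLine x y
  members-of {x} {y} l xl = ↔-trans (∈-members l y)
    ( (λ r~y → sameLine-trans _ _ _ (SameLine-sym r~x) r~y)
    , (λ x~y → sameLine-trans _ _ _ r~x x~y))
    where
    r~x : SameLine (proj₁ l) x
    r~x = proj₁ (∈-members l x) xl

  members-disjoint : ∀ l l′ x → x ∈ₛ members l → x ∈ₛ members l′ → l ≡ l′
  members-disjoint l@(_ , p) l′@(_ , p′) x xl xl′ = Line-≡ (canonical-unique
    (sameLine-trans _ _ _ (proj₁ (∈-members l x) xl) (SameLine-sym (proj₁ (∈-members l′ x) xl′)))
    (does-true⇒ em p) (does-true⇒ em p′))

  SameLine-convex : SameLine x y → x ≼ z → z ≼ y → SameLine x z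
  SameLine-convex {x} {y} {z} (_ , between) x≼z z≼y = inj₁ x≼z , λ
    { w (inj₁ (x≼w , w≼z)) → between w (inj₁ (x≼w , transitive w z y w≼z z≼y))
    ; w (inj₂ (z≼w , w≼x)) → between w (inj₁ (transitive x z w x≼z z≼w , transitive w x y w≼x x≼y)) }
    where
    x≼y : x ≼ y
    x≼y = transitive x z y x≼z z≼y

  InAxis-upward : InAxis x → x ≼ y → InAxis y
  InAxis-upward {x} {y} x-in-axis x≼y z y≼z = x-in-axis z (transitive x y z x≼y y≼z)

  InAxis-SameLine : InAxis x → InAxis y → SameLine x y
  InAxis-SameLine {x} {y} x-in-axis y-in-axis with joins x y
  ... | j , x≼j , y≼j , _ =
    sameLine-trans x j y (to-join x-in-axis x≼j) (SameLine-sym (to-join y-in-axis y≼j))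
    where
    to-join : ∀ {a} → InAxis a → a ≼ j → SameLine a j
    to-join {a} a-in-axis a≼j =
      inj₁ a≼j , λ z a-z-j → (λ _ → even z a-z-j) , (λ _ → a-in-axis a (reflexive a))
      where
      even : ∀ z → Between a z j ⊎ Between j z a → z ∈ₛ N₀
      even z (inj₁ (a≼z , _)) = a-in-axis z a≼z
      even z (inj₂ (j≼z , _)) = InAxis-upward a-in-axis a≼j z j≼z

  InAxis-SameLine-closed : InAxis x → SameLine x y → InAxis y
  InAxis-SameLine-closed x-in-axis (inj₁ x≼y , _) = InAxis-upward x-in-axis x≼y
  InAxis-SameLine-closed {x} {y} x-in-axis (inj₂ y≼x , between) w y≼w with upLinear y x w y≼x y≼w
  ... | inj₁ x≼w = x-in-axis w x≼w
  ... | inj₂ w≼x = proj₁ (between w (inj₂ (y≼w , w≼x))) (x-in-axis x (reflexive x))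

  axisLine : Line
  axisLine = lineOf (proj₁ axisNonempty)

  ∈axisLine⇔InAxis : x ∈ₛ members axisLine ↔ InAxis x
  ∈axisLine⇔InAxis {x} =
      (λ xa → InAxis-SameLine-closed rep-in-axis (proj₁ (∈-members axisLine x) xa))
    , (λ x-in-axis → proj₂ (∈-members axisLine x) (InAxis-SameLine rep-in-axis x-in-axis))
    where
    rep-in-axis : InAxis (proj₁ axisLine)
    rep-in-axis = InAxis-SameLine-closed (proj₂ axisNonempty)
                    (proj₁ (proj₂ (canonical-exists (proj₁ axisNonempty))))

  off-axis : ∀ l → x ∈ₛ members l → ¬ l ≡ axisLine → ¬ InAxis x
  off-axis {x} l xl l≢axis x-in-axis =
    l≢axis (members-disjoint l axisLine x xl (proj₂ ∈axisLine⇔InAxis x-in-axis))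

  rep∈members : ∀ l → proj₁ l ∈ₛ members l
  rep∈members l = proj₂ (∈-members l _) (SameLine-refl (proj₁ l))

  top-of-line : ∀ l → x ∈ₛ members l → IsLineTop x t → IsTop (members l) t
  top-of-line l xl = proj₁ (IsLineTop⇔IsTop λ y → members-of l xl)

  members-isLine : ∀ l → IsLine (members l)
  members-isLine l =
      (λ x y xl yl → proj₁ (proj₁ (members-of l xl) yl))
    , (λ x y z xl yl x≼z z≼y → proj₂ (members-of l xl) (SameLine-convex (proj₁ (members-of l xl) yl) x≼z z≼y))

  axisLine-up : UpClosed (members axisLine)
  axisLine-up x y xa x≼y = proj₂ ∈axisLine⇔InAxis (InAxis-upward (proj₁ ∈axisLine⇔InAxis xa) x≼y)

  axisLine-unique : ∀ l → UpClosed (members l) → l ≡ axisLine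
  axisLine-unique l up with em {InAxis (proj₁ l)}
  ... | yes rep-in-axis =
    members-disjoint l axisLine (proj₁ l) (rep∈members l) (proj₂ ∈axisLine⇔InAxis rep-in-axis)
  ... | no rep-off-axis with lineTops (proj₁ l) rep-off-axis
  ...   | t , T , _ =
    contradiction refl (proj₂ (bound t (up (proj₁ l) t rl (proj₁ (bound (proj₁ l) rl)))))
    where
    rl : proj₁ l ∈ₛ members l
    rl = rep∈members l
    bound : StrictUpperBound (members l) t
    bound = proj₁ (top-of-line l rl T)

  line-tops : ∀ l → ¬ l ≡ axisLine → Σ N (IsTop (members l))
  line-tops l l≢axis with lineTops (proj₁ l) (off-axis l (rep∈members l) l≢axis)
  ... | t , T , _ = t , top-of-line l (rep∈members l) T

  HasDepth : N → ℕ → Set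
  HasDepth = Depth members axisLine

  lineOf-off-axis : ¬ InAxis x → ¬ lineOf x ≡ axisLine
  lineOf-off-axis {x} x-off-axis x-on-axis =
    x-off-axis (proj₁ ∈axisLine⇔InAxis (subst (λ l → x ∈ₛ members l) x-on-axis (∈-lineOf x)))

  depth-exists : ∀ x → Σ ℕ (HasDepth x)
  depth-exists x = does-true⇒ em (lineTop-induction HasSomeDepth (base , step) x)
    where
    HasSomeDepth : Subset N
    HasSomeDepth y = does (em {Σ ℕ (HasDepth y)})
    base : ∀ x → InAxis x → x ∈ₛ HasSomeDepth
    base x x-in-axis = dec-true em (0 , d-axis x (proj₂ ∈axisLine⇔InAxis x-in-axis))
    step : ∀ x → ¬ InAxis x → (∀ t → IsLineTop x t → t ∈ₛ HasSomeDepth) → x ∈ₛ HasSomeDepth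
    step x x-off-axis tops-have-depth with lineTops x x-off-axis
    ... | t , T , _ with does-true⇒ em (tops-have-depth t T)
    ...   | k , d = dec-true em (suc k , d-step x (lineOf x) t k (∈-lineOf x) (lineOf-off-axis x-off-axis)
                                              (top-of-line (lineOf x) (∈-lineOf x) T) d)

  depth-parity : ∀ {k} → HasDepth x k → x ∈ₛ N₀ ↔ 2 ∣ k
  depth-parity (d-axis x xa) = (λ _ → 2 ∣0) , (λ _ → proj₁ ∈axisLine⇔InAxis xa x (reflexive x))
  depth-parity (d-step x l t k xl l≢axis T d) with lineTops x (off-axis l xl l≢axis)
  ... | t′ , T′ , flips with top-unique antisym T (top-of-line l xl T′)
  ...   | refl = parity-flip (N₀ x ≟ true) flips (depth-parity d)

  structuring : IsStructuring members
  structuring = record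
    { nonempty = λ l → proj₁ l , rep∈members l
    ; line = members-isLine
    ; cover = λ x → lineOf x , ∈-lineOf x
    ; disjoint = members-disjoint
    ; axis = axisLine
    ; axisUp = axisLine-up
    ; axisUniq = axisLine-unique
    ; tops = line-tops
    ; finiteDepth = depth-exists
    }

  sjTree : SJTree N le
  sjTree = record
    { joinTree = record
      { countable = countable ; reflexive = reflexive ; antisym = antisym
      ; trans = transitive ; upLinear = upLinear ; joins = joins }
    ; Idx = Line
    ; block = members
    ; structuring = structuring
    }

  sjTree-is-S : IsS sjTree N₀ N₁
  sjTree-is-S = (λ x → (λ x∈N₀ → let (k , d) = depth-exists x in k , d , proj₁ (depth-parity d) x∈N₀)
                     , (λ (_ , d , 2∣k) → proj₂ (depth-parity d) 2∣k))
              , complement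

module _ (em : ExcludedMiddle 0ℓ) {N : Set} {le : N → N → Bool} (J : SJTree N le)
         (N₀ N₁ : Subset N) (J-is-S : IsS J N₀ N₁) where
  open SJTree J
  open Semantics em le
  open SJTreeFacts em J N₀ N₁ J-is-S

  θAx-defines-axis : (X : Subset N) → Sat le noVars ⟨ X , N₀ , N₁ ⟩₃ θAx ↔ (∀ x → X x ≡ block axis x)
  θAx-defines-axis X = ↔-trans
    (Π-cong λ x → ⇔-cong em ↔-refl (sat-inAxisᶠ (extend x noVars) ⟨ X , N₀ , N₁ ⟩₃ 0F 1F))
    (axis-defined-by-InAxis X)

  θ-defines-line-tops : (u : N) (U : Subset N) → Sat le ⟨ u ⟩₁ ⟨ U , N₀ , N₁ ⟩₃ θ ↔
                        (Σ Idx (λ i → ∀ x → U x ≡ block i x) × Order.IsTop le U u)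
  θ-defines-line-tops u U = ×-cong
    (↔-trans (Σ-cong λ x → ×-cong ↔-refl (Π-cong λ y →
               ⇔-cong em ↔-refl (sat-sameLineᶠ (extend y (extend x ⟨ u ⟩₁)) σ 1F 0F 1F)))
             (lines-defined-by-SameLine U))
    (sat-isTopᶠ ⟨ u ⟩₁ σ 0F 0F)
    where
    σ : Fin 3 → Subset N
    σ = ⟨ U , N₀ , N₁ ⟩₃

φ-defines-S : ExcludedMiddle 0ℓ → (N : Set) → Countable N → (le : N → N → Bool) → (N₀ N₁ : Subset N) →
              Sat le noVars ⟨ N₀ , N₁ ⟩₂ φ ↔ Σ (SJTree N le) (λ J → IsS J N₀ N₁)
φ-defines-S em N countable le N₀ N₁ =
    (λ sat → let open SJTreeFromAxioms em countable (proj₁ (sat-φ em le N₀ N₁) sat) in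
             sjTree , sjTree-is-S)
  , (λ (J , J-is-S) → proj₂ (sat-φ em le N₀ N₁) (SJTreeFacts.S-satisfies-SJAxioms em J N₀ N₁ J-is-S))

proposition3p7 : Proposition3p7
proposition3p7 = (φ , φ-defines-S) , θAx , θ , λ em N le J N₀ N₁ J-is-S →
  θAx-defines-axis em J N₀ N₁ J-is-S , θ-defines-line-tops em J N₀ N₁ J-is-S
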